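{- Let $k\geq 2$ and $n\geq 1$ be integers with $nk$ even, and let $G$ be a complete balanced $k$-partite graph with $n$ vertices in each part. If $t$ is an integer with $(k-1)n\leq t\leq \left(\frac{3}{2}k-1\right)n-1$, then $G$ has an interval $t$-coloring.
   Context: All graphs are finite, undirected, without loops or multiple edges. A complete $k$-partite graph is a graph whose vertex set is partitioned into $k$ independent sets $V_1,\ldots,V_k$ such that every vertex of $V_i$ is adjacent to every vertex of $V_j$ for all $i\neq j$; it is balanced if $|V_1|=\cdots=|V_k|$. An edge-coloring of a graph $G$ with colors $1,\ldots,t$ is an interval $t$-coloring if every color $1,\ldots,t$ is used on at least one edge, and for each vertex the colors of the edges incident to it are pairwise distinct and form a set of consecutive integers. -}

module Defs where

open import Data.Nat using (ℕ; _≤_; _+_; _*_)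
open import Data.Fin using (Fin)
open import Data.Product using (Σ; _×_; _,_; ∃-syntax; proj₁)
open import Relation.Binary.PropositionalEquality using (_≡_; sym; refl)
open import Relation.Nullary using (¬_)

record Graph (V : Set) : Set₁ where
  field
    Adj       : V → V → Set
    Adj-sym   : ∀ {u v} → Adj u v → Adj v u
    Adj-irrefl : ∀ {u} → ¬ Adj u u

-- The complete balanced k-partite graph K_{n,...,n}: vertex (i , a) is the
-- a-th vertex of part V_i; two vertices are adjacent iff they lie in
-- different parts.
CompleteBalancedMultipartite : (k n : ℕ) → Graph (Fin k × Fin n)
CompleteBalancedMultipartite k n = record
  { Adj        = λ u v → ¬ (proj₁ u ≡ proj₁ v)
  ; Adj-sym    = λ p q → p (sym q)
  ; Adj-irrefl = λ p → p refl
  }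

-- An interval t-coloring of G.  An edge coloring assigns a colour to every
-- ordered adjacent pair, symmetrically (so it is a colouring of edges).
record IntervalColoring {V : Set} (G : Graph V) (t : ℕ) : Set where
  open Graph G
  field
    col       : (u v : V) → Adj u v → ℕ
    col-sym   : ∀ u v (e : Adj u v) → col v u (Adj-sym e) ≡ col u v e
    col-range : ∀ u v (e : Adj u v) → 1 ≤ col u v e × col u v e ≤ t
    col-used  : ∀ c → 1 ≤ c → c ≤ t → Σ V λ u → Σ V λ v → Σ (Adj u v) λ e → col u v e ≡ c
    proper    : ∀ u v w (e : Adj u v) (f : Adj u w) → col u v e ≡ col u w f → v ≡ w
    interval  : ∀ u → Σ ℕ λ lo → Σ ℕ λ hi →
                  (∀ v (e : Adj u v) → lo ≤ col u v e × col u v e ≤ hi) ×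
                  (∀ c → lo ≤ c → c ≤ hi → Σ V λ v → Σ (Adj u v) λ e → col u v e ≡ c)

module Submission where

-- The proof runs through window colourings: symmetric proper colourings of
-- K_{k×n} by natural numbers in which the colours at each vertex u lie in a
-- window [start u , start u + D) whose length D = (k-1)n is the degree, the
-- starts filling a range [b , b + s] (s is the spread).  In turn we prove
--  * counting: colours injective into a window of length D fill that window;
--  * folding: a window colouring with spread s < D gives an interval
--    t-colouring for every D ≤ t ≤ s + D, by moving each colour ≥ t down by D;
--  * blowing up: replacing each vertex of K_{k×r} by P copies turns a window
--    colouring of spread s into one of K_{k×rP} with spread Ps + P - 1;
--  * two base cases, round robins on finite points plus an apex: the
--    complete graph K_{2M} with spread M - 1, and K_{k×2} with spread k - 1.
-- Both bases have spread kn/2 - 1, which blowing up preserves.  As k odd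
-- forces n even, K_{k×n} is a blow-up of a base, and folding yields every t
-- with (k-1)n ≤ t ≤ (k-1)n + kn/2 - 1, which is the claimed range.

open import Defs
open import Data.Nat using (ℕ; _≤_; _+_; _*_; _∸_)
open import Data.Nat.Divisibility using (_∣_)
open import Data.Nat using (zero; suc; _<_; _⊓_; _/_; _%_; z≤n; s≤s; s≤s⁻¹; z<s; _≤?_; _<?_)
open import Data.Nat.Properties
open import Data.Nat.DivMod using (m%n<n; m≡m%n+[m/n]*n)
open import Data.Nat.Divisibility using (divides; ∣m+n∣m⇒∣n)
open import Data.Nat.Tactic.RingSolver using (solve-∀)
open import Data.Fin as Fin using (Fin; toℕ; fromℕ<; punchIn; punchOut; remQuot; combine)
import Data.Fin.Properties as Finₚ
open import Data.Product using (Σ; ∃; _×_; _,_; proj₁; proj₂; uncurry)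
open import Data.Empty using (⊥; ⊥-elim)
open import Function using (_∘_)
open import Function.Definitions using (Injective)
open import Relation.Binary.PropositionalEquality
open import Relation.Binary.Definitions using (tri<; tri≈; tri>)
open import Relation.Nullary using (¬_; yes; no; contradiction)

Vertex : ℕ → ℕ → Set
Vertex k n = Fin k × Fin n

_~_ : ∀ {k n} → Vertex k n → Vertex k n → Set
u ~ v = ¬ (proj₁ u ≡ proj₁ v)

degree : ℕ → ℕ → ℕ
degree k n = (k ∸ 1) * n

∸-below : ∀ {x a w} → a ≤ x → x < a + w → x ∸ a < w
∸-below {x} {a} {w} a≤x x<a+w =
  +-cancelˡ-< a (x ∸ a) w (subst (_< a + w) (sym (m+[n∸m]≡n a≤x)) x<a+w)

injective⇒onto : ∀ {N} (f : Fin N → Fin N) → Injective _≡_ _≡_ f → ∀ y → ∃ λ x → f x ≡ y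
injective⇒onto {suc N} f f-injective y with Finₚ.any? (λ x → f x Fin.≟ y)
... | yes hit = hit
... | no miss = ⊥-elim (1+n≰n (Finₚ.injective⇒≤ squeeze-injective))
  where
  avoids : ∀ x → y ≢ f x
  avoids x eq = miss (x , sym eq)
  -- if y were missed, f would squeeze Fin (suc N) injectively into Fin N
  squeeze : Fin (suc N) → Fin N
  squeeze x = punchOut (avoids x)
  squeeze-injective : Injective _≡_ _≡_ squeeze
  squeeze-injective eq = f-injective (Finₚ.punchOut-injective (avoids _) (avoids _) eq)

module _ {k n : ℕ} (u : Vertex (suc k) n) where

  neighbour : Fin (k * n) → Vertex (suc k) n
  neighbour x = punchIn (proj₁ u) (proj₁ (remQuot {k} n x)) , proj₂ (remQuot {k} n x)

  neighbour-adjacent : ∀ x → u ~ neighbour x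
  neighbour-adjacent x eq = Finₚ.punchInᵢ≢i (proj₁ u) _ (sym eq)

  neighbour-injective : Injective _≡_ _≡_ neighbour
  neighbour-injective {x} {y} eq = begin
    x                                 ≡⟨ Finₚ.combine-remQuot {k} n x ⟨
    uncurry combine (remQuot {k} n x) ≡⟨ cong (uncurry combine) same-digits ⟩
    uncurry combine (remQuot {k} n y) ≡⟨ Finₚ.combine-remQuot {k} n y ⟩
    y                                 ∎
    where
    open ≡-Reasoning
    same-digits : remQuot {k} n x ≡ remQuot {k} n y
    same-digits = cong₂ _,_
      (Finₚ.punchIn-injective (proj₁ u) _ _ (cong proj₁ eq)) (cong proj₂ eq)

neighbours-fill-window : ∀ {k n} (u : Vertex k n) (f : Vertex k n → ℕ) (lo : ℕ) →
  (∀ v → u ~ v → lo ≤ f v × f v < lo + degree k n) →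
  (∀ v w → u ~ v → u ~ w → f v ≡ f w → v ≡ w) →
  ∀ c → lo ≤ c → c < lo + degree k n → Σ (Vertex k n) λ v → u ~ v × f v ≡ c
neighbours-fill-window {suc k} {n} u f lo in-window f-injective c lo≤c c<hi =
  neighbour u x , adjacent x , ∸-cancelʳ-≡ (lower x) lo≤c same-offset
  where
  adjacent : ∀ x → u ~ neighbour u x
  adjacent = neighbour-adjacent u
  lower : ∀ x → lo ≤ f (neighbour u x)
  lower x = proj₁ (in-window _ (adjacent x))
  offset-bound : ∀ x → f (neighbour u x) ∸ lo < k * n
  offset-bound x = ∸-below (lower x) (proj₂ (in-window _ (adjacent x)))
  offset : Fin (k * n) → Fin (k * n)
  offset x = fromℕ< (offset-bound x)
  offset-injective : Injective _≡_ _≡_ offset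
  offset-injective {x} {y} eq = neighbour-injective u (f-injective _ _ (adjacent x) (adjacent y)
    (∸-cancelʳ-≡ (lower x) (lower y) (Finₚ.fromℕ<-injective _ _ (offset-bound x) (offset-bound y) eq)))
  target : Fin (k * n)
  target = fromℕ< (∸-below lo≤c c<hi)
  preimage : ∃ λ x → offset x ≡ target
  preimage = injective⇒onto offset offset-injective target
  x : Fin (k * n)
  x = proj₁ preimage
  same-offset : f (neighbour u x) ∸ lo ≡ c ∸ lo
  same-offset = Finₚ.fromℕ<-injective _ _ (offset-bound x) (∸-below lo≤c c<hi) (proj₂ preimage)

-- A window colouring of K_{k×n} with base b and spread s: a symmetric edge
-- colouring by natural numbers, proper at every vertex u, whose colours at u
-- lie in the window [start u , start u + degree k n); the window starts fill
-- exactly the range [b , b + s].  (By counting, the colours at u then form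
-- the whole window.)
record WindowColouring (k n b s : ℕ) : Set where
  field
    colour           : Vertex k n → Vertex k n → ℕ
    start            : Vertex k n → ℕ
    colour-sym       : ∀ u v → colour u v ≡ colour v u
    colour-in-window : ∀ u v → u ~ v → start u ≤ colour u v × colour u v < start u + degree k n
    colour-injective : ∀ u v w → u ~ v → u ~ w → colour u v ≡ colour u w → v ≡ w
    start-bounds     : ∀ u → b ≤ start u × start u ≤ b + s
    start-onto       : ∀ c → c ≤ s → Σ (Vertex k n) λ u → start u ≡ b + c

lowerBase : ∀ {k n b s} → WindowColouring k n b s → WindowColouring k n 0 s
lowerBase {k} {n} {b} {s} W = record
  { colour           = λ u v → colour u v ∸ b
  ; start            = λ u → start u ∸ b
  ; colour-sym       = λ u v → cong (_∸ b) (colour-sym u v)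
  ; colour-in-window = λ u v e →
      ∸-monoˡ-≤ b (proj₁ (colour-in-window u v e)) ,
      subst (colour u v ∸ b <_) (+-∸-comm (degree k n) (b≤start u))
        (∸-monoˡ-< (proj₂ (colour-in-window u v e)) (b≤colour u v e))
  ; colour-injective = λ u v w e f eq →
      colour-injective u v w e f (∸-cancelʳ-≡ (b≤colour u v e) (b≤colour u w f) eq)
  ; start-bounds     = λ u → z≤n ,
      subst (start u ∸ b ≤_) (m+n∸m≡n b s) (∸-monoˡ-≤ b (proj₂ (start-bounds u)))
  ; start-onto       = λ c c≤s → let (u , eq) = start-onto c c≤s in
      u , trans (cong (_∸ b) eq) (m+n∸m≡n b c)
  }
  where
  open WindowColouring W
  b≤start : ∀ u → b ≤ start u
  b≤start u = proj₁ (start-bounds u)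
  b≤colour : ∀ u v → u ~ v → b ≤ colour u v
  b≤colour u v e = ≤-trans (b≤start u) (proj₁ (colour-in-window u v e))

-- Folding a window colouring with base 0 and spread s into an interval
-- t-colouring, for every t with D ≤ t ≤ s + D (D the degree): every colour
-- x ≥ t is replaced by x - D.  A window [l , l + D) with l ≤ t is thereby
-- mapped injectively into the window [l ⊓ (t - D) , l ⊓ (t - D) + D), which
-- ends at or below t.
module Folding {k n s : ℕ} (W : WindowColouring k n 0 s) (t : ℕ)
               (s<D : s < degree k n) (D≤t : degree k n ≤ t) (t≤s+D : t ≤ s + degree k n) where
  open WindowColouring W

  D : ℕ
  D = degree k n

  fold : ℕ → ℕ
  fold x with t ≤? x
  ... | yes _ = x ∸ D
  ... | no  _ = x

  foldStart : ℕ → ℕ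
  foldStart l = l ⊓ (t ∸ D)

  foldStart+D : ∀ l → foldStart l + D ≡ (l + D) ⊓ t
  foldStart+D l = trans (+-distribʳ-⊓ D l (t ∸ D)) (cong ((l + D) ⊓_) (m∸n+n≡m D≤t))

  folded-below : ∀ {l x} → D ≤ x → x < l + D → x ∸ D < l
  folded-below {l} {x} D≤x x<l+D = ∸-below D≤x (subst (x <_) (+-comm l D) x<l+D)

  fold-in-window : ∀ l x → l ≤ t → l ≤ x → x < l + D → foldStart l ≤ fold x × fold x < foldStart l + D
  fold-in-window l x l≤t l≤x x<l+D with t ≤? x
  ... | no  x≮t = ≤-trans (m⊓n≤m l (t ∸ D)) l≤x ,
                  subst (x <_) (sym (foldStart+D l)) (⊓-pres-m< x<l+D (≰⇒> x≮t))
  ... | yes t≤x = ≤-trans (m⊓n≤n l (t ∸ D)) (∸-monoˡ-≤ D t≤x) ,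
                  subst (x ∸ D <_) (sym (foldStart+D l))
                    (⊓-pres-m< (≤-trans below (m≤m+n l D)) (<-≤-trans below l≤t))
    where
    below : x ∸ D < l
    below = folded-below (≤-trans D≤t t≤x) x<l+D

  fold-injective : ∀ l x y → l ≤ x → x < l + D → l ≤ y → y < l + D → fold x ≡ fold y → x ≡ y
  fold-injective l x y l≤x x<l+D l≤y y<l+D eq with t ≤? x | t ≤? y
  ... | no  _   | no  _   = eq
  ... | yes t≤x | yes t≤y = ∸-cancelʳ-≡ (≤-trans D≤t t≤x) (≤-trans D≤t t≤y) eq
  ... | yes t≤x | no  _   = ⊥-elim (<⇒≢ (<-≤-trans (folded-below (≤-trans D≤t t≤x) x<l+D) l≤y) eq)
  ... | no  _   | yes t≤y = ⊥-elim (<⇒≢ (<-≤-trans (folded-below (≤-trans D≤t t≤y) y<l+D) l≤x) (sym eq))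

  start≤t : ∀ u → start u ≤ t
  start≤t u = ≤-trans (proj₂ (start-bounds u)) (≤-trans (<⇒≤ s<D) D≤t)

  low : Vertex k n → ℕ
  low u = foldStart (start u)

  folded : Vertex k n → Vertex k n → ℕ
  folded u v = fold (colour u v)

  folded-in-window : ∀ u v → u ~ v → low u ≤ folded u v × folded u v < low u + D
  folded-in-window u v e =
    fold-in-window (start u) (colour u v) (start≤t u)
      (proj₁ (colour-in-window u v e)) (proj₂ (colour-in-window u v e))

  folded-injective : ∀ u v w → u ~ v → u ~ w → folded u v ≡ folded u w → v ≡ w
  folded-injective u v w e f eq = colour-injective u v w e f
    (fold-injective (start u) (colour u v) (colour u w)
      (proj₁ (colour-in-window u v e)) (proj₂ (colour-in-window u v e))
      (proj₁ (colour-in-window u w f)) (proj₂ (colour-in-window u w f)) eq)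

  low+D≤t : ∀ u → low u + D ≤ t
  low+D≤t u = subst (_≤ t) (sym (foldStart+D (start u))) (m⊓n≤n (start u + D) t)

  folded-fills : ∀ u c → low u ≤ c → c < low u + D → Σ (Vertex k n) λ v → u ~ v × folded u v ≡ c
  folded-fills u = neighbours-fill-window u (folded u) (low u) (folded-in-window u) (folded-injective u)

  -- colour c < t is attained at a vertex whose window starts at c ⊓ (t - D)
  every-colour-folded : ∀ c → c < t → Σ (Vertex k n) λ u → Σ (Vertex k n) λ v → u ~ v × folded u v ≡ c
  every-colour-folded c c<t = u , folded-fills u c low≤c c<low+D
    where
    bound : c ⊓ (t ∸ D) ≤ s
    bound = ≤-trans (m⊓n≤n c (t ∸ D)) (subst (t ∸ D ≤_) (m+n∸n≡m s D) (∸-monoˡ-≤ D t≤s+D))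
    u : Vertex k n
    u = proj₁ (start-onto (c ⊓ (t ∸ D)) bound)
    low≡ : low u ≡ foldStart c
    low≡ = trans (cong foldStart (proj₂ (start-onto (c ⊓ (t ∸ D)) bound)))
                 (m≤n⇒m⊓n≡m (m⊓n≤n c (t ∸ D)))
    low≤c : low u ≤ c
    low≤c = subst (_≤ c) (sym low≡) (m⊓n≤m c (t ∸ D))
    c<low+D : c < low u + D
    c<low+D = subst (c <_) (sym (trans (cong (_+ D) low≡) (foldStart+D c)))
                (⊓-pres-m< (m<m+n c (<-≤-trans z<s s<D)) c<t)

  intervalColouring : IntervalColoring (CompleteBalancedMultipartite k n) t
  intervalColouring = record
    { col       = λ u v _ → suc (folded u v)
    ; col-sym   = λ u v _ → cong (suc ∘ fold) (colour-sym v u)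
    ; col-range = λ u v e → s≤s z≤n , ≤-trans (proj₂ (folded-in-window u v e)) (low+D≤t u)
    ; col-used  = used
    ; proper    = λ u v w e f eq → folded-injective u v w e f (suc-injective eq)
    ; interval  = λ u → suc (low u) , low u + D ,
                        (λ v e → s≤s (proj₁ (folded-in-window u v e)) , proj₂ (folded-in-window u v e)) ,
                        fills u
    }
    where
    used : ∀ c → 1 ≤ c → c ≤ t →
           Σ (Vertex k n) λ u → Σ (Vertex k n) λ v → Σ (u ~ v) λ _ → suc (folded u v) ≡ c
    used (suc c) _ c<t =
      let (u , v , e , eq) = every-colour-folded c c<t in u , v , e , cong suc eq
    fills : ∀ u c → suc (low u) ≤ c → c ≤ low u + D →
            Σ (Vertex k n) λ v → Σ (u ~ v) λ _ → suc (folded u v) ≡ c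
    fills u (suc c) (s≤s low≤c) c<low+D =
      let (v , e , eq) = folded-fills u c low≤c c<low+D in v , e , cong suc eq

-- Base-P digits: in P * c + o with o < P the "digit" o cannot compensate a larger c.
digits-< : ∀ P {c₁ c₂} o₁ o₂ → o₁ < P → c₁ < c₂ → P * c₁ + o₁ < P * c₂ + o₂
digits-< P {c₁} {c₂} o₁ o₂ o₁<P c₁<c₂ = begin-strict
  P * c₁ + o₁ <⟨ +-monoʳ-< (P * c₁) o₁<P ⟩
  P * c₁ + P  ≡⟨ trans (+-comm (P * c₁) P) (sym (*-suc P c₁)) ⟩
  P * suc c₁  ≤⟨ *-monoʳ-≤ P c₁<c₂ ⟩
  P * c₂      ≤⟨ m≤m+n (P * c₂) o₂ ⟩
  P * c₂ + o₂ ∎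
  where open ≤-Reasoning

digits-unique : ∀ P {c₁ c₂ o₁ o₂} → o₁ < P → o₂ < P → P * c₁ + o₁ ≡ P * c₂ + o₂ → c₁ ≡ c₂
digits-unique P {c₁} {c₂} {o₁} {o₂} o₁<P o₂<P eq with <-cmp c₁ c₂
... | tri< c₁<c₂ _ _ = ⊥-elim (<⇒≢ (digits-< P o₁ o₂ o₁<P c₁<c₂) eq)
... | tri≈ _ c₁≡c₂ _ = c₁≡c₂
... | tri> _ _ c₂<c₁ = ⊥-elim (<⇒≢ (digits-< P o₂ o₁ o₂<P c₂<c₁) (sym eq))

scaled-window : ∀ P {l c w} o o' → o' < P → l ≤ c → c < l + w →
  P * l + o ≤ P * c + o + o' × P * c + o + o' < P * l + o + P * w
scaled-window P {l} {c} {w} o o' o'<P l≤c c<l+w =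
  ≤-trans (+-monoˡ-≤ o (*-monoʳ-≤ P l≤c)) (m≤m+n (P * c + o) o') ,
  (begin-strict
    P * c + o + o'    <⟨ +-monoʳ-< (P * c + o) o'<P ⟩
    P * c + o + P     ≡⟨ shift P c o ⟩
    P * suc c + o     ≤⟨ +-monoˡ-≤ o (*-monoʳ-≤ P c<l+w) ⟩
    P * (l + w) + o   ≡⟨ distribute P l w o ⟩
    P * l + o + P * w ∎)
  where
  open ≤-Reasoning
  shift : ∀ P c o → P * c + o + P ≡ P * suc c + o
  shift = solve-∀
  distribute : ∀ P l w o → P * (l + w) + o ≡ P * l + o + P * w
  distribute = solve-∀

-- Copy number o of u and copy o' of v get colour
-- P c(u,v) + o + o', so the window of copy o of u is P·(window of u) + o.
module BlowUp {k r b s : ℕ} (p : ℕ) (W : WindowColouring k r b s) where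
  open WindowColouring W

  P : ℕ
  P = suc p

  -- the vertex of K_{k×r} that u is a copy of, and which copy it is
  shadow : Vertex k (r * P) → Vertex k r
  shadow (i , a) = i , proj₁ (remQuot {r} P a)

  offset : Vertex k (r * P) → ℕ
  offset (_ , a) = toℕ (proj₂ (remQuot {r} P a))

  offset<P : ∀ u → offset u < P
  offset<P (_ , a) = Finₚ.toℕ<n (proj₂ (remQuot {r} P a))

  shadow-offset-injective : ∀ u v → shadow u ≡ shadow v → offset u ≡ offset v → u ≡ v
  shadow-offset-injective (i , a) (j , a') same-shadow same-offset =
    cong₂ _,_ (cong proj₁ same-shadow) (begin
      a                                  ≡⟨ Finₚ.combine-remQuot {r} P a ⟨
      uncurry combine (remQuot {r} P a)  ≡⟨ cong (uncurry combine) same-digits ⟩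
      uncurry combine (remQuot {r} P a') ≡⟨ Finₚ.combine-remQuot {r} P a' ⟩
      a'                                 ∎)
    where
    open ≡-Reasoning
    same-digits : remQuot {r} P a ≡ remQuot {r} P a'
    same-digits = cong₂ _,_ (cong proj₂ same-shadow) (Finₚ.toℕ-injective same-offset)

  blownColour : Vertex k (r * P) → Vertex k (r * P) → ℕ
  blownColour u v = P * colour (shadow u) (shadow v) + offset u + offset v

  blownStart : Vertex k (r * P) → ℕ
  blownStart u = P * start (shadow u) + offset u

  degree-scales : P * degree k r ≡ degree k (r * P)
  degree-scales = rearrange (k ∸ 1) r P
    where
    rearrange : ∀ d r P → P * (d * r) ≡ d * (r * P)
    rearrange = solve-∀

  blownColour-injective : ∀ u v w → u ~ v → u ~ w → blownColour u v ≡ blownColour u w → v ≡ w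
  blownColour-injective u v w e f eq =
    shadow-offset-injective v w (colour-injective (shadow u) (shadow v) (shadow w) e f same-colour) same-offset
    where
    reorder : ∀ x y z → y + (x + z) ≡ x + y + z
    reorder = solve-∀
    eq′ : P * colour (shadow u) (shadow v) + offset v ≡ P * colour (shadow u) (shadow w) + offset w
    eq′ = +-cancelˡ-≡ (offset u) _ _
      (trans (reorder _ (offset u) (offset v)) (trans eq (sym (reorder _ (offset u) (offset w)))))
    same-colour : colour (shadow u) (shadow v) ≡ colour (shadow u) (shadow w)
    same-colour = digits-unique P (offset<P v) (offset<P w) eq′
    same-offset : offset v ≡ offset w
    same-offset = +-cancelˡ-≡ _ _ _ (trans eq′ (cong (λ c → P * c + offset w) (sym same-colour)))

  blownStart-bounds : ∀ u → P * b ≤ blownStart u × blownStart u ≤ P * b + (P * s + p)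
  blownStart-bounds u =
    ≤-trans (*-monoʳ-≤ P (proj₁ (start-bounds (shadow u)))) (m≤m+n _ (offset u)) ,
    (begin
      P * start (shadow u) + offset u
        ≤⟨ +-mono-≤ (*-monoʳ-≤ P (proj₂ (start-bounds (shadow u)))) (s≤s⁻¹ (offset<P u)) ⟩
      P * (b + s) + p                 ≡⟨ distribute P b s p ⟩
      P * b + (P * s + p)             ∎)
    where
    open ≤-Reasoning hiding (start)
    distribute : ∀ P b s p → P * (b + s) + p ≡ P * b + (P * s + p)
    distribute = solve-∀

  -- c = P Q + R: take copy R of a vertex whose window starts at b + Q
  blownStart-onto : ∀ c → c ≤ P * s + p → Σ (Vertex k (r * P)) λ u → blownStart u ≡ P * b + c
  blownStart-onto c c≤ = (proj₁ u , combine (proj₂ u) R′) , (begin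
      P * start (proj₁ u , proj₁ (remQuot {r} P (combine (proj₂ u) R′)))
        + toℕ (proj₂ (remQuot {r} P (combine (proj₂ u) R′)))
        ≡⟨ cong (λ d → P * start (proj₁ u , proj₁ d) + toℕ (proj₂ d)) (Finₚ.remQuot-combine (proj₂ u) R′) ⟩
      P * start u + toℕ R′       ≡⟨ cong₂ (λ l o → P * l + o) start≡ (Finₚ.toℕ-fromℕ< R<P) ⟩
      P * (b + Q) + R            ≡⟨ distribute P b Q R ⟩
      P * b + (P * Q + R)        ≡⟨ cong (P * b +_) (sym c≡) ⟩
      P * b + c                  ∎)
    where
    open ≡-Reasoning
    distribute : ∀ P b Q R → P * (b + Q) + R ≡ P * b + (P * Q + R)
    distribute = solve-∀
    Q R : ℕ
    Q = c / P
    R = c % P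
    R<P : R < P
    R<P = m%n<n c P
    R′ : Fin P
    R′ = fromℕ< R<P
    c≡ : c ≡ P * Q + R
    c≡ = trans (m≡m%n+[m/n]*n c P) (trans (+-comm R (Q * P)) (cong (_+ R) (*-comm Q P)))
    Q≤s : Q ≤ s
    Q≤s with Q ≤? s
    ... | yes Q≤s = Q≤s
    ... | no  Q≰s = ⊥-elim (<⇒≱ (digits-< P p R ≤-refl (≰⇒> Q≰s)) (subst (_≤ P * s + p) c≡ c≤))
    u : Vertex k r
    u = proj₁ (start-onto Q Q≤s)
    start≡ : start u ≡ b + Q
    start≡ = proj₂ (start-onto Q Q≤s)

  blowUp : WindowColouring k (r * P) (P * b) (P * s + p)
  blowUp = record
    { colour           = blownColour
    ; start            = blownStart
    ; colour-sym       = λ u v → trans (cong (λ c → P * c + offset u + offset v) (colour-sym (shadow u) (shadow v)))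
                                       (swap-offsets _ (offset u) (offset v))
    ; colour-in-window = λ u v e →
        let (l≤c , c<l+D) = colour-in-window (shadow u) (shadow v) e
            (lower , upper) = scaled-window P (offset u) (offset v) (offset<P v) l≤c c<l+D
        in lower , subst (λ d → blownColour u v < blownStart u + d) degree-scales upper
    ; colour-injective = blownColour-injective
    ; start-bounds     = blownStart-bounds
    ; start-onto       = blownStart-onto
    }
    where
    swap-offsets : ∀ x y z → x + y + z ≡ x + z + y
    swap-offsets = solve-∀

-- The round-robin picture behind both base colourings: finite points labelled
-- by naturals, plus one apex.
data Point : Set where
  apex : Point
  pt   : ℕ → Point

pt-injective : ∀ {x y} → pt x ≡ pt y → x ≡ y
pt-injective refl = refl

-- The finite point whose colour with x represents the edge from pt x to w:
-- w itself, or x when w is the apex.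
partner : ℕ → Point → ℕ
partner x apex   = x
partner x (pt y) = y

partner-injective : ∀ x {w w′} → w ≢ pt x → w′ ≢ pt x → partner x w ≡ partner x w′ → w ≡ w′
partner-injective x {apex} {apex}  _  _   _  = refl
partner-injective x {apex} {pt y′} _  w′≢ eq = ⊥-elim (w′≢ (cong pt (sym eq)))
partner-injective x {pt y} {apex}  w≢ _   eq = ⊥-elim (w≢ (cong pt eq))
partner-injective x {pt y} {pt y′} _  _   eq = cong pt eq

-- A colouring E of pairs of finite points extends to all points by giving
-- the edge between pt x and the apex the diagonal colour E x x.
apexColour : (ℕ → ℕ → ℕ) → Point → Point → ℕ
apexColour E (pt x) w      = E x (partner x w)
apexColour E apex   (pt y) = E y y
apexColour E apex   apex   = 0

apexColour-sym : ∀ {E} → (∀ x y → E x y ≡ E y x) → ∀ w w′ → apexColour E w w′ ≡ apexColour E w′ w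
apexColour-sym E-sym (pt x) (pt y) = E-sym x y
apexColour-sym E-sym (pt x) apex   = refl
apexColour-sym E-sym apex   (pt y) = refl
apexColour-sym E-sym apex   apex   = refl

Joined : (ℕ → ℕ → Set) → Point → Point → Set
Joined Adm (pt x) w      = Adm x (partner x w)
Joined Adm apex   (pt y) = Adm y y
Joined Adm apex   apex   = ⊥

-- A window colouring presented in the round-robin picture: the vertices of
-- K_{k×n} are coded injectively by points, adjacent vertices by joined
-- points, and the windows (of width D) are checked on admissible pairs.
record ApexScheme (k n D b s : ℕ) : Set₁ where
  field
    E                : ℕ → ℕ → ℕ
    E-sym            : ∀ x y → E x y ≡ E y x
    Adm              : ℕ → ℕ → Set
    code             : Vertex k n → Point
    code-injective   : ∀ u v → code u ≡ code v → u ≡ v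
    code-joined      : ∀ u v → u ~ v → Joined Adm (code u) (code v)
    start            : Point → ℕ
    finite-window    : ∀ x y → Adm x y → start (pt x) ≤ E x y × E x y < start (pt x) + D
    finite-injective : ∀ x y y′ → Adm x y → Adm x y′ → E x y ≡ E x y′ → y ≡ y′
    apex-window      : ∀ y → Adm y y → start apex ≤ E y y × E y y < start apex + D
    apex-injective   : ∀ y y′ → Adm y y → Adm y′ y′ → E y y ≡ E y′ y′ → y ≡ y′
    start-bounds     : ∀ u → b ≤ start (code u) × start (code u) ≤ b + s
    start-onto       : ∀ c → c ≤ s → Σ (Vertex k n) λ u → start (code u) ≡ b + c

module _ {k n D b s : ℕ} (A : ApexScheme k n D b s) where
  open ApexScheme A

  point-window : ∀ w w′ → Joined Adm w w′ → start w ≤ apexColour E w w′ × apexColour E w w′ < start w + D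
  point-window (pt x) w′     adm = finite-window x (partner x w′) adm
  point-window apex   (pt y) adm = apex-window y adm

  point-injective : ∀ w w₁ w₂ → Joined Adm w w₁ → Joined Adm w w₂ → w₁ ≢ w → w₂ ≢ w →
                    apexColour E w w₁ ≡ apexColour E w w₂ → w₁ ≡ w₂
  point-injective (pt x) w₁      w₂      adm₁ adm₂ w₁≢ w₂≢ eq =
    partner-injective x w₁≢ w₂≢ (finite-injective x _ _ adm₁ adm₂ eq)
  point-injective apex   (pt y₁) (pt y₂) adm₁ adm₂ _   _   eq = cong pt (apex-injective y₁ y₂ adm₁ adm₂ eq)

  code-distinct : ∀ u v → u ~ v → code v ≢ code u
  code-distinct u v e eq = e (cong proj₁ (code-injective u v (sym eq)))

  apexWindowColouring : D ≡ degree k n → WindowColouring k n b s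
  apexWindowColouring refl = record
    { colour           = λ u v → apexColour E (code u) (code v)
    ; start            = λ u → start (code u)
    ; colour-sym       = λ u v → apexColour-sym E-sym (code u) (code v)
    ; colour-in-window = λ u v e → point-window (code u) (code v) (code-joined u v e)
    ; colour-injective = λ u v w e f eq → code-injective v w
        (point-injective (code u) (code v) (code w) (code-joined u v e) (code-joined u w f)
          (code-distinct u v e) (code-distinct u w f) eq)
    ; start-bounds     = start-bounds
    ; start-onto       = start-onto
    }

double-injective : ∀ {a b} → a + a ≡ b + b → a ≡ b
double-injective {a} {b} eq = *-cancelˡ-≡ a b 2 (trans (double a) (trans eq (sym (double b))))
  where
  double : ∀ a → 2 * a ≡ a + a
  double = solve-∀

double≢odd : ∀ a b → a + a ≢ suc (b + b)
double≢odd a b eq = even≢odd a b (trans (double a) (trans eq (cong suc (sym (double b)))))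
  where
  double : ∀ a → 2 * a ≡ a + a
  double = solve-∀

matched : ∀ {c c′ a b : ℕ} → c ≡ c′ → c ≡ a → c′ ≡ b → a ≡ b
matched eq e e′ = trans (sym e) (trans eq e′)

≤-by : ∀ {a b} d → a + d ≡ b → a ≤ b
≤-by {a} d eq = subst (a ≤_) eq (m≤m+n a d)

<-by : ∀ {a b} d → a + suc d ≡ b → a < b
<-by {a} d eq = subst (a <_) eq (m<m+n a z<s)

-- The complete graph K_{2M} (M = m + 1) as a round robin on the finite
-- points 0 … q-1 (q = 2m + 1) and the apex.  The finite edge xy gets colour
-- x + y, lifted by q when its smaller end is below M; the apex edge of x gets
-- 2x, lifted likewise.  Windows (width q) start at q for the apex, x + q for
-- x < M and x + M for x ≥ M: these starts fill [q , q + m].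
module EvenBase (m : ℕ) where

  M q : ℕ
  M = suc m
  q = M + m

  M≤q : M ≤ q
  M≤q = m≤m+n M m

  lift : ℕ → ℕ
  lift z with z <? M
  ... | yes _ = q
  ... | no  _ = 0

  E : ℕ → ℕ → ℕ
  E x y = x + y + lift (x ⊓ y)

  E-sym : ∀ x y → E x y ≡ E y x
  E-sym x y = cong₂ _+_ (+-comm x y) (cong lift (⊓-comm x y))

  E-lifted : ∀ x y → x ⊓ y < M → E x y ≡ x + y + q
  E-lifted x y min<M with x ⊓ y <? M
  ... | yes _    = refl
  ... | no  min≮M = ⊥-elim (min≮M min<M)

  E-unlifted : ∀ x y → M ≤ x → M ≤ y → E x y ≡ x + y
  E-unlifted x y M≤x M≤y with x ⊓ y <? M
  ... | yes min<M = ⊥-elim (<⇒≱ min<M (⊓-glb M≤x M≤y))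
  ... | no  _     = +-identityʳ (x + y)

  data Size (x : ℕ) : Set where
    small : x < M → Size x
    large : M ≤ x → Size x

  size : ∀ x → Size x
  size x with x <? M
  ... | yes x<M = small x<M
  ... | no  x≮M = large (≮⇒≥ x≮M)

  start : Point → ℕ
  start apex = q
  start (pt x) with size x
  ... | small _ = x + q
  ... | large _ = x + M

  Adm : ℕ → ℕ → Set
  Adm x y = x < q × y < q

  -- at a small x all colours are lifted; at a large x exactly those to small y
  finite-window : ∀ x y → Adm x y → start (pt x) ≤ E x y × E x y < start (pt x) + q
  finite-window x y (x<q , y<q) with size x | size y
  ... | small x<M | _ rewrite E-lifted x y (≤-<-trans (m⊓n≤m x y) x<M) =
    +-monoˡ-≤ q (m≤m+n x y) , +-monoˡ-< q (+-monoʳ-< x y<q)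
  ... | large M≤x | small y<M rewrite E-lifted x y (≤-<-trans (m⊓n≤n x y) y<M) =
    ≤-trans (+-monoʳ-≤ x M≤q) (+-monoˡ-≤ q (m≤m+n x y)) , +-monoˡ-< q (+-monoʳ-< x y<M)
  ... | large M≤x | large M≤y rewrite E-unlifted x y M≤x M≤y =
    +-monoʳ-≤ x M≤y , <-≤-trans (+-monoʳ-< x y<q) (+-monoˡ-≤ q (m≤m+n x M))

  lifted≢unlifted : ∀ x y y′ → y′ < q → x + y + q ≢ x + y′
  lifted≢unlifted x y y′ y′<q eq = <⇒≱ y′<q (subst (q ≤_) y+q≡y′ (m≤n+m q y))
    where
    y+q≡y′ : y + q ≡ y′
    y+q≡y′ = +-cancelˡ-≡ x _ _ (trans (sym (+-assoc x y q)) eq)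

  finite-injective : ∀ x y y′ → Adm x y → Adm x y′ → E x y ≡ E x y′ → y ≡ y′
  finite-injective x y y′ (_ , y<q) (_ , y′<q) eq with size x | size y | size y′
  ... | small x<M | _ | _
    rewrite E-lifted x y (≤-<-trans (m⊓n≤m x y) x<M) | E-lifted x y′ (≤-<-trans (m⊓n≤m x y′) x<M) =
    +-cancelˡ-≡ x _ _ (+-cancelʳ-≡ q _ _ eq)
  ... | large _ | small y<M | small y′<M
    rewrite E-lifted x y (≤-<-trans (m⊓n≤n x y) y<M) | E-lifted x y′ (≤-<-trans (m⊓n≤n x y′) y′<M) =
    +-cancelˡ-≡ x _ _ (+-cancelʳ-≡ q _ _ eq)
  ... | large M≤x | large M≤y | large M≤y′ rewrite E-unlifted x y M≤x M≤y | E-unlifted x y′ M≤x M≤y′ =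
    +-cancelˡ-≡ x _ _ eq
  ... | large M≤x | small y<M | large M≤y′
    rewrite E-lifted x y (≤-<-trans (m⊓n≤n x y) y<M) | E-unlifted x y′ M≤x M≤y′ =
    ⊥-elim (lifted≢unlifted x y y′ y′<q eq)
  ... | large M≤x | large M≤y | small y′<M
    rewrite E-unlifted x y M≤x M≤y | E-lifted x y′ (≤-<-trans (m⊓n≤n x y′) y′<M) =
    ⊥-elim (lifted≢unlifted x y′ y y<q (sym eq))

  -- lifted diagonals 2y + q (y ≤ m) and unlifted ones 2y (y ≥ M) both lie in [q , 2q)
  apex-window : ∀ y → Adm y y → q ≤ E y y × E y y < q + q
  apex-window y (y<q , _) with size y
  ... | small y<M rewrite E-lifted y y (≤-<-trans (m⊓n≤m y y) y<M) =
    m≤n+m q (y + y) , +-monoˡ-< q (s≤s (+-mono-≤ (s≤s⁻¹ y<M) (s≤s⁻¹ y<M)))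
  ... | large M≤y rewrite E-unlifted y y M≤y M≤y =
    ≤-trans (+-monoʳ-≤ M (n≤1+n m)) (+-mono-≤ M≤y M≤y) , +-mono-< y<q y<q

  -- since q is odd, a lifted diagonal colour is odd
  lifted-double-odd : ∀ y → y + y + q ≡ suc ((y + m) + (y + m))
  lifted-double-odd y = rearrange y m
    where
    rearrange : ∀ y m → y + y + suc (m + m) ≡ suc ((y + m) + (y + m))
    rearrange = solve-∀

  -- diagonals of equal lift are distinct; lifted ones are odd, unlifted ones even
  apex-injective : ∀ y y′ → Adm y y → Adm y′ y′ → E y y ≡ E y′ y′ → y ≡ y′
  apex-injective y y′ _ _ eq with size y | size y′
  ... | small y<M | small y′<M
    rewrite E-lifted y y (≤-<-trans (m⊓n≤m y y) y<M) | E-lifted y′ y′ (≤-<-trans (m⊓n≤m y′ y′) y′<M) =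
    double-injective (+-cancelʳ-≡ q _ _ eq)
  ... | large M≤y | large M≤y′ rewrite E-unlifted y y M≤y M≤y | E-unlifted y′ y′ M≤y′ M≤y′ =
    double-injective eq
  ... | small y<M | large M≤y′
    rewrite E-lifted y y (≤-<-trans (m⊓n≤m y y) y<M) | E-unlifted y′ y′ M≤y′ M≤y′ =
    ⊥-elim (double≢odd y′ (y + m) (trans (sym eq) (lifted-double-odd y)))
  ... | large M≤y | small y′<M
    rewrite E-unlifted y y M≤y M≤y | E-lifted y′ y′ (≤-<-trans (m⊓n≤m y′ y′) y′<M) =
    ⊥-elim (double≢odd y (y′ + m) (trans eq (lifted-double-odd y′)))

  code : Vertex (suc q) 1 → Point
  code (Fin.zero  , _) = apex
  code (Fin.suc i , _) = pt (toℕ i)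

  code-injective : ∀ u v → code u ≡ code v → u ≡ v
  code-injective (Fin.zero  , Fin.zero) (Fin.zero  , Fin.zero) _  = refl
  code-injective (Fin.suc i , Fin.zero) (Fin.suc j , Fin.zero) eq =
    cong (λ i → Fin.suc i , Fin.zero) (Finₚ.toℕ-injective (pt-injective eq))

  code-joined : ∀ u v → u ~ v → Joined Adm (code u) (code v)
  code-joined (Fin.zero  , _) (Fin.zero  , _) e = ⊥-elim (e refl)
  code-joined (Fin.zero  , _) (Fin.suc j , _) _ = Finₚ.toℕ<n j , Finₚ.toℕ<n j
  code-joined (Fin.suc i , _) (Fin.zero  , _) _ = Finₚ.toℕ<n i , Finₚ.toℕ<n i
  code-joined (Fin.suc i , _) (Fin.suc j , _) _ = Finₚ.toℕ<n i , Finₚ.toℕ<n j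

  -- the starts lie in [q , q + m], and the small points (with the apex) attain all of it
  finite-start-bounds : ∀ x → x < q → q ≤ start (pt x) × start (pt x) ≤ q + m
  finite-start-bounds x x<q with size x
  ... | small x<M = m≤n+m q x , subst (x + q ≤_) (+-comm m q) (+-monoˡ-≤ q (s≤s⁻¹ x<M))
  ... | large M≤x = ≤-trans (+-monoʳ-≤ M (n≤1+n m)) (+-monoˡ-≤ M M≤x) ,
                    ≤-trans (+-monoˡ-≤ M (s≤s⁻¹ x<q)) (≤-reflexive (rearrange m))
    where
    rearrange : ∀ m → m + m + suc m ≡ suc m + m + m
    rearrange = solve-∀

  start-bounds : ∀ u → q ≤ start (code u) × start (code u) ≤ q + m
  start-bounds (Fin.zero  , _) = ≤-refl , m≤m+n q m
  start-bounds (Fin.suc i , _) = finite-start-bounds (toℕ i) (Finₚ.toℕ<n i)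

  start-small : ∀ x → x < M → start (pt x) ≡ x + q
  start-small x x<M with size x
  ... | small _   = refl
  ... | large M≤x = ⊥-elim (<⇒≱ x<M M≤x)

  start-onto : ∀ c → c ≤ m → Σ (Vertex (suc q) 1) λ u → start (code u) ≡ q + c
  start-onto c c≤m = (Fin.suc (fromℕ< c<q) , Fin.zero) ,
    trans (cong (λ x → start (pt x)) (Finₚ.toℕ-fromℕ< c<q)) (trans (start-small c (s≤s c≤m)) (+-comm c q))
    where
    c<q : c < q
    c<q = <-≤-trans (s≤s c≤m) M≤q

  scheme : ApexScheme (suc q) 1 q q m
  scheme = record
    { E                = E
    ; E-sym            = E-sym
    ; Adm              = Adm
    ; code             = code
    ; code-injective   = code-injective
    ; code-joined      = code-joined
    ; start            = start
    ; finite-window    = finite-window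
    ; finite-injective = finite-injective
    ; apex-window      = apex-window
    ; apex-injective   = apex-injective
    ; start-bounds     = start-bounds
    ; start-onto       = start-onto
    }

evenBase : ∀ m → WindowColouring (suc (suc m + m)) 1 (suc m + m) m
evenBase m = apexWindowColouring (EvenBase.scheme m) (sym (*-identityʳ (suc m + m)))

-- The graph K_{k×2} (k = K + 1 ≥ 2) as a round robin on the finite points
-- 0 … q-1 (q = 2K + 1) and the apex, in which x and q - x (x ≥ 1), and 0 and
-- the apex, form the parts.  The edge xy (x + y ≠ q) gets colour x + y plus
--   1      if both ends exceed k   (band "top"),
--   q + 1  otherwise, if x + y < q (band "below"),
--   q      otherwise               (band "above"),
-- the apex edge of x gets the diagonal colour of x.  Windows have width
-- D = 2K and start at q + 2 for 0, x + q + 1 for 1 ≤ x ≤ k, x + k + 2 for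
-- x > k and q + 3 for the apex: these starts fill [q + 2 , q + 2 + K].
module OddBase (j : ℕ) where

  K k D q : ℕ
  K = suc j
  k = suc K
  D = K + K
  q = suc D

  k<q : k < q
  k<q = s≤s (s≤s (m≤n+m (suc j) j))

  q≤k+k : q ≤ k + k
  q≤k+k = s≤s (+-monoʳ-≤ K (n≤1+n K))

  bonus : ℕ → ℕ → ℕ
  bonus s z with k <? z
  ... | yes _ = 1
  ... | no  _ with s <? q
  ...   | yes _ = suc q
  ...   | no  _ = q

  E : ℕ → ℕ → ℕ
  E x y = x + y + bonus (x + y) (x ⊓ y)

  E-sym : ∀ x y → E x y ≡ E y x
  E-sym x y = cong₂ _+_ (+-comm x y) (cong₂ bonus (+-comm x y) (⊓-comm x y))

  data Band (x y : ℕ) : Set where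
    below : x + y < q → E x y ≡ x + y + suc q → Band x y
    above : q < x + y → x ⊓ y ≤ k → E x y ≡ x + y + q → Band x y
    top   : k < x ⊓ y → E x y ≡ x + y + 1 → Band x y

  E-top : ∀ x y → k < x ⊓ y → E x y ≡ x + y + 1
  E-top x y k<min with k <? x ⊓ y
  ... | yes _     = refl
  ... | no  k≮min = ⊥-elim (k≮min k<min)

  E-below : ∀ x y → ¬ k < x ⊓ y → x + y < q → E x y ≡ x + y + suc q
  E-below x y k≮min sum<q with k <? x ⊓ y
  ... | yes k<min = ⊥-elim (k≮min k<min)
  ... | no  _ with x + y <? q
  ...   | yes _     = refl
  ...   | no  sum≮q = ⊥-elim (sum≮q sum<q)

  E-above : ∀ x y → ¬ k < x ⊓ y → ¬ x + y < q → E x y ≡ x + y + q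
  E-above x y k≮min sum≮q with k <? x ⊓ y
  ... | yes k<min = ⊥-elim (k≮min k<min)
  ... | no  _ with x + y <? q
  ...   | yes sum<q = ⊥-elim (sum≮q sum<q)
  ...   | no  _     = refl

  band : ∀ x y → x + y ≢ q → Band x y
  band x y sum≢q with k <? x ⊓ y
  ... | yes k<min = top k<min (E-top x y k<min)
  ... | no  k≮min with x + y <? q
  ...   | yes sum<q = below sum<q (E-below x y k≮min sum<q)
  ...   | no  sum≮q = above (≤∧≢⇒< (≮⇒≥ sum≮q) (sum≢q ∘ sym)) (≮⇒≥ k≮min) (E-above x y k≮min sum≮q)

  -- admissible pairs: the pair (x , y) represents an edge, or (x , x) the apex edge of x ≠ 0
  record Adm (x y : ℕ) : Set where
    constructor adm
    field
      left<q  : x < q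
      right<q : y < q
      sum≢q   : x + y ≢ q
      sum>0   : 0 < x + y
  open Adm

  data Place : ℕ → Set where
    origin : Place 0
    middle : ∀ {x} → 0 < x → x ≤ k → Place x
    high   : ∀ {x} → k < x → Place x

  place : ∀ x → Place x
  place zero = origin
  place (suc x) with suc x ≤? k
  ... | yes x≤k = middle z<s x≤k
  ... | no  x≰k = high (≰⇒> x≰k)

  startAt : ∀ {x} → Place x → ℕ
  startAt origin           = suc (suc q)
  startAt (middle {x} _ _) = x + suc q
  startAt (high {x} _)     = x + suc (suc k)

  start : Point → ℕ
  start apex   = suc (suc (suc q))
  start (pt x) = startAt (place x)

  translate : ∀ x y β σ → σ ≤ y + β → y + β < σ + D → x + σ ≤ x + y + β × x + y + β < x + σ + D
  translate x y β σ lower upper =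
    subst (x + σ ≤_) (sym (+-assoc x y β)) (+-monoʳ-≤ x lower) ,
    subst₂ _<_ (sym (+-assoc x y β)) (sym (+-assoc x σ D)) (+-monoʳ-< x upper)

  above⇒pos : ∀ x y → x < q → q < x + y → 0 < y
  above⇒pos x zero    x<q q<x+y = ⊥-elim (<-asym x<q (subst (q <_) (+-identityʳ x) q<x+y))
  above⇒pos x (suc y) _   _     = z<s

  below⇒y<D : ∀ x y → 0 < x → x + y < q → y < D
  below⇒y<D x y 0<x sum<q = s≤s⁻¹ (≤-<-trans (+-monoˡ-≤ y 0<x) sum<q)

  below⇒y<k : ∀ x y → k < x → x + y < q → y < k
  below⇒y<k x y k<x sum<q =
    +-cancelˡ-< k y k (<-trans (n<1+n (k + y)) (<-≤-trans (≤-<-trans (+-monoˡ-≤ y k<x) sum<q) q≤k+k))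

  above⇒y≤k : ∀ x y → k < x → x ⊓ y ≤ k → y ≤ k
  above⇒y≤k x y k<x min≤k with y ≤? k
  ... | yes y≤k = y≤k
  ... | no  y≰k = ⊥-elim (<⇒≱ (⊓-pres-m< k<x (≰⇒> y≰k)) min≤k)

  end-origin : D + suc q < suc (suc q) + D
  end-origin = <-by 0 (rearrange K)
    where
    rearrange : ∀ K → K + K + suc (suc (K + K)) + 1 ≡ suc (suc (suc (K + K))) + (K + K)
    rearrange = solve-∀

  end-middle : q + q ≡ suc q + D
  end-middle = rearrange K
    where
    rearrange : ∀ K → suc (K + K) + suc (K + K) ≡ suc (suc (K + K)) + (K + K)
    rearrange = solve-∀

  end-high-below : k + suc q ≡ suc (suc k) + D
  end-high-below = rearrange K
    where
    rearrange : ∀ K → suc K + suc (suc (K + K)) ≡ suc (suc (suc K)) + (K + K)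
    rearrange = solve-∀

  end-high-above : k + q < suc (suc k) + D
  end-high-above = <-by 0 (rearrange K)
    where
    rearrange : ∀ K → suc K + suc (K + K) + 1 ≡ suc (suc (suc K)) + (K + K)
    rearrange = solve-∀

  end-high-top : q < suc (suc k) + D
  end-high-top = <-by (suc K) (rearrange K)
    where
    rearrange : ∀ K → suc (K + K) + suc (suc K) ≡ suc (suc (suc K)) + (K + K)
    rearrange = solve-∀

  finite-window : ∀ x y → Adm x y → start (pt x) ≤ E x y × E x y < start (pt x) + D
  finite-window x y a with place x | band x y (sum≢q a)
  ... | origin | below _ eq rewrite eq =
    translate 0 y (suc q) (suc (suc q)) (+-monoˡ-≤ (suc q) (sum>0 a))
      (≤-<-trans (+-monoˡ-≤ (suc q) (s≤s⁻¹ (right<q a))) end-origin)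
  ... | origin | above q<y _ _ = ⊥-elim (<-asym (right<q a) q<y)
  ... | origin | top k<0 _     = ⊥-elim (<⇒≱ k<0 z≤n)
  ... | middle 0<x _ | below sum<q eq rewrite eq =
    translate x y (suc q) (suc q) (m≤n+m (suc q) y)
      (subst (_< suc q + D) (+-comm (suc q) y) (+-monoʳ-< (suc q) (below⇒y<D x y 0<x sum<q)))
  ... | middle _ _ | above q<sum _ eq rewrite eq =
    translate x y q (suc q) (+-monoˡ-≤ q (above⇒pos x y (left<q a) q<sum))
      (subst (y + q <_) end-middle (+-monoˡ-< q (right<q a)))
  ... | middle _ x≤k | top k<min _ = ⊥-elim (<⇒≱ k<min (≤-trans (m⊓n≤m x y) x≤k))
  ... | high k<x | below sum<q eq rewrite eq =
    translate x y (suc q) (suc (suc k)) (≤-trans (s≤s k<q) (m≤n+m (suc q) y))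
      (subst (y + suc q <_) end-high-below (+-monoˡ-< (suc q) (below⇒y<k x y k<x sum<q)))
  ... | high k<x | above q<sum min≤k eq rewrite eq =
    translate x y q (suc (suc k)) (+-mono-≤ (above⇒pos x y (left<q a) q<sum) k<q)
      (≤-<-trans (+-monoˡ-≤ q (above⇒y≤k x y k<x min≤k)) end-high-above)
  ... | high _ | top k<min eq rewrite eq =
    translate x y 1 (suc (suc k))
      (subst (suc (suc k) ≤_) (+-comm 1 y) (s≤s (<-≤-trans k<min (m⊓n≤n x y))))
      (≤-<-trans (subst (_≤ q) (+-comm 1 y) (right<q a)) end-high-top)

  diagonal-below : ∀ y → y + y + suc q ≡ suc (y + K) + suc (y + K)
  diagonal-below y = rearrange y K
    where
    rearrange : ∀ y K → y + y + suc (suc (K + K)) ≡ suc (y + K) + suc (y + K)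
    rearrange = solve-∀

  diagonal-above : ∀ y → y + y + q ≡ suc ((y + K) + (y + K))
  diagonal-above y = rearrange y K
    where
    rearrange : ∀ y K → y + y + suc (K + K) ≡ suc ((y + K) + (y + K))
    rearrange = solve-∀

  diagonal-top : ∀ y → y + y + 1 ≡ suc (y + y)
  diagonal-top y = +-comm (y + y) 1

  double-pos : ∀ y → 0 < y + y → 0 < y
  double-pos (suc y) _ = z<s

  3≤q : 3 ≤ q
  3≤q = ≤-trans (s≤s (s≤s (s≤s z≤n))) k<q

  apex-window : ∀ y → Adm y y → start apex ≤ E y y × E y y < start apex + D
  apex-window y a with band y y (sum≢q a)
  ... | below sum<q eq rewrite eq =
    +-monoˡ-≤ (suc q) (+-mono-≤ (double-pos y (sum>0 a)) (double-pos y (sum>0 a))) ,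
    ≤-<-trans (+-monoˡ-≤ (suc q) (s≤s⁻¹ sum<q)) (<-by 1 (rearrange K))
    where
    rearrange : ∀ K → K + K + suc (suc (K + K)) + 2 ≡ suc (suc (suc (suc (K + K)))) + (K + K)
    rearrange = solve-∀
  ... | above q<sum min≤k eq rewrite eq =
    +-monoˡ-≤ q (<⇒≤ (≤-<-trans 3≤q q<sum)) ,
    ≤-<-trans (+-monoˡ-≤ q (+-mono-≤ y≤k y≤k)) (<-by 0 (rearrange K))
    where
    y≤k : y ≤ k
    y≤k = subst (_≤ k) (⊓-idem y) min≤k
    rearrange : ∀ K → suc K + suc K + suc (K + K) + 1 ≡ suc (suc (suc (suc (K + K)))) + (K + K)
    rearrange = solve-∀
  ... | top k<min eq rewrite eq =
    ≤-trans (≤-by 1 (rearrange₁ K)) (+-monoˡ-≤ 1 (+-mono-≤ k<y k<y)) ,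
    ≤-<-trans (+-monoˡ-≤ 1 (+-mono-≤ y≤D y≤D)) (<-by 2 (rearrange₂ K))
    where
    k<y : k < y
    k<y = subst (k <_) (⊓-idem y) k<min
    y≤D : y ≤ D
    y≤D = s≤s⁻¹ (right<q a)
    rearrange₁ : ∀ K → suc (suc (suc (suc (K + K)))) + 1 ≡ suc (suc K) + suc (suc K) + 1
    rearrange₁ = solve-∀
    rearrange₂ : ∀ K → K + K + (K + K) + 1 + 3 ≡ suc (suc (suc (suc (K + K)))) + (K + K)
    rearrange₂ = solve-∀

  lifted≢ : ∀ a {y′} → a + q ≡ y′ → ¬ y′ < q
  lifted≢ a eq y′<q = <⇒≱ y′<q (subst (q ≤_) eq (m≤n+m q a))

  cancel-front : ∀ x {a b c d} → x + a + c ≡ x + b + d → a + c ≡ b + d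
  cancel-front x {a} {b} {c} {d} eq =
    +-cancelˡ-≡ x (a + c) (b + d) (trans (sym (+-assoc x a c)) (trans eq (+-assoc x b d)))

  below≢above : ∀ x y y′ → x + y < q → q < x + y′ → y + suc q ≢ y′ + q
  below≢above x y y′ sum<q q<sum′ eq =
    <⇒≱ q<sum′ (subst (_≤ q) (cong (x +_) y′≡) (subst (_≤ q) (sym (+-suc x y)) sum<q))
    where
    y′≡ : suc y ≡ y′
    y′≡ = +-cancelʳ-≡ q (suc y) y′ (trans (sym (+-suc y q)) eq)

  below≢top : ∀ y y′ → y′ < q → y + suc q ≢ y′ + 1
  below≢top y y′ y′<q eq = lifted≢ y (suc-injective (trans (sym (+-suc y q)) (trans eq (+-comm y′ 1)))) y′<q

  above≢top : ∀ y y′ → 0 < y → y′ < q → y + q ≢ y′ + 1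
  above≢top (suc y) y′ _ y′<q eq = lifted≢ y (suc-injective (trans eq (+-comm y′ 1))) y′<q

  finite-injective : ∀ x y y′ → Adm x y → Adm x y′ → E x y ≡ E x y′ → y ≡ y′
  finite-injective x y y′ a a′ eq with band x y (sum≢q a) | band x y′ (sum≢q a′)
  ... | below _ e   | below _ e′   = +-cancelʳ-≡ (suc q) y y′ (cancel-front x (matched eq e e′))
  ... | above _ _ e | above _ _ e′ = +-cancelʳ-≡ q y y′ (cancel-front x (matched eq e e′))
  ... | top _ e     | top _ e′     = +-cancelʳ-≡ 1 y y′ (cancel-front x (matched eq e e′))
  ... | below sum<q e | above q<sum′ _ e′ =
    ⊥-elim (below≢above x y y′ sum<q q<sum′ (cancel-front x (matched eq e e′)))
  ... | above q<sum _ e | below sum′<q e′ =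
    ⊥-elim (below≢above x y′ y sum′<q q<sum (cancel-front x (matched (sym eq) e′ e)))
  ... | below _ e | top _ e′ = ⊥-elim (below≢top y y′ (right<q a′) (cancel-front x (matched eq e e′)))
  ... | top _ e | below _ e′ = ⊥-elim (below≢top y′ y (right<q a) (cancel-front x (matched (sym eq) e′ e)))
  ... | above q<sum _ e | top _ e′ =
    ⊥-elim (above≢top y y′ (above⇒pos x y (left<q a) q<sum) (right<q a′) (cancel-front x (matched eq e e′)))
  ... | top _ e | above q<sum′ _ e′ =
    ⊥-elim (above≢top y′ y (above⇒pos x y′ (left<q a) q<sum′) (right<q a) (cancel-front x (matched (sym eq) e′ e)))

  above⇒y+K≥q : ∀ y → q < y + y → q ≤ y + K
  above⇒y+K≥q y q<y+y with K <? y
  ... | yes K<y = +-monoˡ-≤ K K<y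
  ... | no  K≮y = ⊥-elim (<-asym q<y+y (s≤s (+-mono-≤ (≮⇒≥ K≮y) (≮⇒≥ K≮y))))

  data Diagonal (y : ℕ) : Set where
    even-below : E y y ≡ suc (y + K) + suc (y + K) → Diagonal y
    odd-above  : q < y + y → E y y ≡ suc ((y + K) + (y + K)) → Diagonal y
    odd-top    : E y y ≡ suc (y + y) → Diagonal y

  diagonal : ∀ y → Adm y y → Diagonal y
  diagonal y a with band y y (sum≢q a)
  ... | below _ e       = even-below (trans e (diagonal-below y))
  ... | above q<sum _ e = odd-above q<sum (trans e (diagonal-above y))
  ... | top _ e         = odd-top (trans e (diagonal-top y))

  -- equal normal forms of one kind cancel and parity separates "below" from the
  -- rest; an "above" colour 2(y + K) + 1 equal to a "top" one forces y′ = y + K ≥ q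
  apex-injective : ∀ y y′ → Adm y y → Adm y′ y′ → E y y ≡ E y′ y′ → y ≡ y′
  apex-injective y y′ a a′ eq with diagonal y a | diagonal y′ a′
  ... | even-below e  | even-below e′  = +-cancelʳ-≡ K y y′ (suc-injective (double-injective (matched eq e e′)))
  ... | odd-above _ e | odd-above _ e′ = +-cancelʳ-≡ K y y′ (double-injective (suc-injective (matched eq e e′)))
  ... | odd-top e     | odd-top e′     = double-injective (suc-injective (matched eq e e′))
  ... | even-below e  | odd-above _ e′ = ⊥-elim (double≢odd (suc (y + K)) (y′ + K) (matched eq e e′))
  ... | odd-above _ e | even-below e′  = ⊥-elim (double≢odd (suc (y′ + K)) (y + K) (matched (sym eq) e′ e))
  ... | even-below e  | odd-top e′     = ⊥-elim (double≢odd (suc (y + K)) y′ (matched eq e e′))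
  ... | odd-top e     | even-below e′  = ⊥-elim (double≢odd (suc (y′ + K)) y (matched (sym eq) e′ e))
  ... | odd-above q<sum e | odd-top e′ = ⊥-elim (<⇒≱ (right<q a′)
    (subst (q ≤_) (double-injective (suc-injective (matched eq e e′))) (above⇒y+K≥q y q<sum)))
  ... | odd-top e | odd-above q<sum′ e′ = ⊥-elim (<⇒≱ (right<q a)
    (subst (q ≤_) (double-injective (suc-injective (matched (sym eq) e′ e))) (above⇒y+K≥q y′ q<sum′)))

  -- part i consists of the points i and q - i (i ≥ 1); part 0 of 0 and the apex
  sheet₁ : Fin K → ℕ
  sheet₁ i = q ∸ suc (toℕ i)

  code : Vertex k 2 → Point
  code (i         , Fin.zero)          = pt (toℕ i)
  code (Fin.zero  , Fin.suc Fin.zero)  = apex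
  code (Fin.suc i , Fin.suc Fin.zero)  = pt (sheet₁ i)

  sheet₀≤K : ∀ (i : Fin k) → toℕ i ≤ K
  sheet₀≤K i = s≤s⁻¹ (Finₚ.toℕ<n i)

  sheet₀<q : ∀ (i : Fin k) → toℕ i < q
  sheet₀<q i = s≤s (≤-trans (sheet₀≤K i) (m≤m+n K K))

  sheet₁-sum : ∀ i → suc (toℕ i) + sheet₁ i ≡ q
  sheet₁-sum i = m+[n∸m]≡n (s≤s (≤-trans (<⇒≤ (Finₚ.toℕ<n i)) (m≤m+n K K)))

  sheet₁<q : ∀ i → sheet₁ i < q
  sheet₁<q i = s≤s (m∸n≤m D (toℕ i))

  K<sheet₁ : ∀ i → K < sheet₁ i
  K<sheet₁ i = +-cancelˡ-< K K (sheet₁ i) (subst (_< K + sheet₁ i) (suc-injective (sheet₁-sum i))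
                 (+-monoˡ-< (sheet₁ i) (Finₚ.toℕ<n i)))

  sheet₀≢sheet₁ : ∀ i i′ → toℕ i ≢ sheet₁ i′
  sheet₀≢sheet₁ i i′ eq = <⇒≱ (K<sheet₁ i′) (subst (_≤ K) eq (sheet₀≤K i))

  -- a sheet-1 point determines its part, since the two points of a part sum to q
  sheet₁-injective : ∀ i i′ → sheet₁ i ≡ sheet₁ i′ → i ≡ i′
  sheet₁-injective i i′ eq = Finₚ.toℕ-injective (suc-injective (+-cancelʳ-≡ (sheet₁ i) _ _
    (trans (sheet₁-sum i) (sym (trans (cong (suc (toℕ i′) +_) eq) (sheet₁-sum i′))))))

  -- sheet-0 points are at most K and sheet-1 points exceed K
  code-injective : ∀ u v → code u ≡ code v → u ≡ v
  code-injective (i , Fin.zero) (i′ , Fin.zero) eq =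
    cong (_, Fin.zero) (Finₚ.toℕ-injective (pt-injective eq))
  code-injective (Fin.zero , Fin.suc Fin.zero) (Fin.zero , Fin.suc Fin.zero) _ = refl
  code-injective (Fin.suc i , Fin.suc Fin.zero) (Fin.suc i′ , Fin.suc Fin.zero) eq =
    cong (λ i → Fin.suc i , Fin.suc Fin.zero) (sheet₁-injective i i′ (pt-injective eq))
  code-injective (Fin.suc i , Fin.suc Fin.zero) (Fin.zero , Fin.suc Fin.zero) ()
  code-injective (i , Fin.zero) (Fin.suc i′ , Fin.suc Fin.zero) eq = ⊥-elim (sheet₀≢sheet₁ i i′ (pt-injective eq))
  code-injective (Fin.suc i , Fin.suc Fin.zero) (i′ , Fin.zero) eq = ⊥-elim (sheet₀≢sheet₁ i′ i (pt-injective (sym eq)))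

  Adm-sym : ∀ {x y} → Adm x y → Adm y x
  Adm-sym {x} {y} (adm x<q y<q sum≢q sum>0) =
    adm y<q x<q (sum≢q ∘ trans (+-comm x y)) (subst (0 <_) (+-comm x y) sum>0)

  apex-admissible : ∀ x → 0 < x → x < q → Adm x x
  apex-admissible x 0<x x<q = adm x<q x<q (double≢odd x K) (<-≤-trans 0<x (m≤m+n x x))

  low-admissible : ∀ x y → x ≤ K → y ≤ K → x ≢ y → Adm x y
  low-admissible x y x≤K y≤K x≢y = adm (s≤s (≤-trans x≤K (m≤m+n K K))) (s≤s (≤-trans y≤K (m≤m+n K K)))
    (<⇒≢ (s≤s (+-mono-≤ x≤K y≤K))) (distinct⇒pos x y x≢y)
    where
    distinct⇒pos : ∀ x y → x ≢ y → 0 < x + y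
    distinct⇒pos zero    zero    x≢y = ⊥-elim (x≢y refl)
    distinct⇒pos zero    (suc y) _   = z<s
    distinct⇒pos (suc x) y       _   = z<s

  high-admissible : ∀ x y → K < x → K < y → x < q → y < q → Adm x y
  high-admissible x y K<x K<y x<q y<q =
    adm x<q y<q (<⇒≢ (<-≤-trans (s≤s (+-monoʳ-< K (n<1+n K))) (+-mono-≤ K<x K<y)) ∘ sym)
      (<-≤-trans z<s (≤-trans K<x (m≤m+n x y)))

  mixed-admissible : ∀ (i : Fin k) i′ → i ≢ Fin.suc i′ → Adm (toℕ i) (sheet₁ i′)
  mixed-admissible i i′ i≢ = adm (sheet₀<q i) (sheet₁<q i′)
    (λ eq → i≢ (Finₚ.toℕ-injective (+-cancelʳ-≡ _ _ _ (trans eq (sym (sheet₁-sum i′))))))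
    (≤-trans (<-≤-trans z<s (K<sheet₁ i′)) (m≤n+m (sheet₁ i′) (toℕ i)))

  code-joined : ∀ u v → u ~ v → Joined Adm (code u) (code v)
  code-joined (i , Fin.zero) (i′ , Fin.zero) e =
    low-admissible (toℕ i) (toℕ i′) (sheet₀≤K i) (sheet₀≤K i′) (e ∘ Finₚ.toℕ-injective)
  code-joined (Fin.zero  , Fin.zero) (Fin.zero , Fin.suc Fin.zero) e = ⊥-elim (e refl)
  code-joined (Fin.suc i , Fin.zero) (Fin.zero , Fin.suc Fin.zero) _ = apex-admissible (suc (toℕ i)) z<s (sheet₀<q (Fin.suc i))
  code-joined (Fin.zero , Fin.suc Fin.zero) (Fin.zero  , Fin.zero) e = ⊥-elim (e refl)
  code-joined (Fin.zero , Fin.suc Fin.zero) (Fin.suc i , Fin.zero) _ = apex-admissible (suc (toℕ i)) z<s (sheet₀<q (Fin.suc i))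
  code-joined (Fin.zero , Fin.suc Fin.zero) (Fin.zero , Fin.suc Fin.zero) e = ⊥-elim (e refl)
  code-joined (Fin.zero , Fin.suc Fin.zero) (Fin.suc i′ , Fin.suc Fin.zero) _ =
    apex-admissible (sheet₁ i′) (<-≤-trans z<s (K<sheet₁ i′)) (sheet₁<q i′)
  code-joined (Fin.suc i′ , Fin.suc Fin.zero) (Fin.zero , Fin.suc Fin.zero) _ =
    apex-admissible (sheet₁ i′) (<-≤-trans z<s (K<sheet₁ i′)) (sheet₁<q i′)
  code-joined (Fin.suc i , Fin.suc Fin.zero) (Fin.suc i′ , Fin.suc Fin.zero) _ =
    high-admissible (sheet₁ i) (sheet₁ i′) (K<sheet₁ i) (K<sheet₁ i′) (sheet₁<q i) (sheet₁<q i′)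
  code-joined (i , Fin.zero) (Fin.suc i′ , Fin.suc Fin.zero) e = mixed-admissible i i′ e
  code-joined (Fin.suc i′ , Fin.suc Fin.zero) (i , Fin.zero) e = Adm-sym (mixed-admissible i i′ (e ∘ sym))

  finite-start-bounds : ∀ x → x < q → suc (suc q) ≤ start (pt x) × start (pt x) ≤ suc (suc q) + K
  finite-start-bounds x x<q with place x
  ... | origin = ≤-refl , m≤m+n (suc (suc q)) K
  ... | middle 0<x x≤k =
    +-monoˡ-≤ (suc q) 0<x , ≤-trans (+-monoˡ-≤ (suc q) x≤k) (≤-reflexive (rearrange K))
    where
    rearrange : ∀ K → suc K + suc (suc (K + K)) ≡ suc (suc (suc (K + K))) + K
    rearrange = solve-∀
  ... | high k<x =
    ≤-trans (≤-by 2 (rearrange₁ K)) (+-monoˡ-≤ (suc (suc k)) k<x) ,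
    ≤-trans (+-monoˡ-≤ (suc (suc k)) (s≤s⁻¹ x<q)) (≤-reflexive (rearrange₂ K))
    where
    rearrange₁ : ∀ K → suc (suc (suc (K + K))) + 2 ≡ suc (suc K) + suc (suc (suc K))
    rearrange₁ = solve-∀
    rearrange₂ : ∀ K → K + K + suc (suc (suc K)) ≡ suc (suc (suc (K + K))) + K
    rearrange₂ = solve-∀

  start-bounds : ∀ u → suc (suc q) ≤ start (code u) × start (code u) ≤ suc (suc q) + K
  start-bounds (i         , Fin.zero)         = finite-start-bounds (toℕ i) (sheet₀<q i)
  start-bounds (Fin.zero  , Fin.suc Fin.zero) = n≤1+n _ , ≤-by j (rearrange j)
    where
    rearrange : ∀ j → suc (suc (suc (suc (suc j + suc j)))) + j ≡ suc (suc (suc (suc j + suc j))) + suc j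
    rearrange = solve-∀
  start-bounds (Fin.suc i , Fin.suc Fin.zero) = finite-start-bounds (sheet₁ i) (sheet₁<q i)

  start-middle : ∀ x → 0 < x → x ≤ k → start (pt x) ≡ x + suc q
  start-middle x 0<x x≤k with place x
  ... | origin     = ⊥-elim (<-irrefl refl 0<x)
  ... | middle _ _ = refl
  ... | high k<x   = ⊥-elim (<⇒≱ k<x x≤k)

  -- every point 1 … k codes a vertex: 1 … K on sheet 0, and k = q - K on sheet 1
  middle-vertex : ∀ x → 0 < x → x ≤ k → Σ (Vertex k 2) λ u → code u ≡ pt x
  middle-vertex x 0<x x≤k with x ≤? K
  ... | yes x≤K = (fromℕ< (s≤s x≤K) , Fin.zero) , cong pt (Finₚ.toℕ-fromℕ< (s≤s x≤K))
  ... | no  x≰K = (Fin.suc (Fin.fromℕ j) , Fin.suc Fin.zero) , cong pt (begin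
      q ∸ suc (toℕ (Fin.fromℕ j)) ≡⟨ cong (λ t → q ∸ suc t) (Finₚ.toℕ-fromℕ j) ⟩
      q ∸ suc j                   ≡⟨ cong (_∸ j) (rearrange j) ⟩
      j + k ∸ j                   ≡⟨ m+n∸m≡n j k ⟩
      k                           ≡⟨ ≤-antisym (≰⇒> x≰K) x≤k ⟩
      x                           ∎)
    where
    open ≡-Reasoning
    rearrange : ∀ j → suc j + suc j ≡ j + suc (suc j)
    rearrange = solve-∀

  -- start q + 2 + c is attained at the middle point c + 1
  start-onto : ∀ c → c ≤ K → Σ (Vertex k 2) λ u → start (code u) ≡ suc (suc q) + c
  start-onto c c≤K = u , trans (cong start code≡) (trans (start-middle (suc c) z<s (s≤s c≤K)) (rearrange c q))
    where
    u : Vertex k 2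
    u = proj₁ (middle-vertex (suc c) z<s (s≤s c≤K))
    code≡ : code u ≡ pt (suc c)
    code≡ = proj₂ (middle-vertex (suc c) z<s (s≤s c≤K))
    rearrange : ∀ c q → suc c + suc q ≡ suc (suc q) + c
    rearrange = solve-∀

  scheme : ApexScheme k 2 D (suc (suc q)) K
  scheme = record
    { E                = E
    ; E-sym            = E-sym
    ; Adm              = Adm
    ; code             = code
    ; code-injective   = code-injective
    ; code-joined      = code-joined
    ; start            = start
    ; finite-window    = finite-window
    ; finite-injective = finite-injective
    ; apex-window      = apex-window
    ; apex-injective   = apex-injective
    ; start-bounds     = start-bounds
    ; start-onto       = start-onto
    }

oddBase : ∀ j → WindowColouring (suc (suc j)) 2 (suc (suc (suc (suc j + suc j)))) (suc j)
oddBase j = apexWindowColouring (OddBase.scheme j) (rearrange j)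
  where
  rearrange : ∀ j → suc j + suc j ≡ suc j * 2
  rearrange = solve-∀

HasWindowColouring : ℕ → ℕ → Set
HasWindowColouring k n = Σ ℕ λ s → 2 * suc s ≡ k * n × WindowColouring k n 0 s

evenCase : ∀ m p → HasWindowColouring (suc m + suc m) (suc p)
evenCase m p = subst₂ HasWindowColouring (cong suc (sym (+-suc m m))) (*-identityˡ (suc p))
  (suc p * m + p , half m p , lowerBase (BlowUp.blowUp p (evenBase m)))
  where
  half : ∀ m p → 2 * suc (suc p * m + p) ≡ suc (suc m + m) * (1 * suc p)
  half = solve-∀

oddCase : ∀ j p → HasWindowColouring (suc (suc j)) (2 * suc p)
oddCase j p = suc p * suc j + p , half j p , lowerBase (BlowUp.blowUp p (oddBase j))
  where
  half : ∀ j p → 2 * suc (suc p * suc j + p) ≡ suc (suc j) * (2 * suc p)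
  half = solve-∀

data Parity : ℕ → Set where
  even : ∀ M → Parity (M + M)
  odd  : ∀ M → Parity (suc (M + M))

parity : ∀ k → Parity k
parity zero = even 0
parity (suc k) with parity k
... | even M = odd M
... | odd  M = subst Parity (cong suc (+-suc M M)) (even (suc M))

odd-factor : ∀ M n → 2 ∣ n * suc (M + M) → 2 ∣ n
odd-factor M n 2∣nk = ∣m+n∣m⇒∣n (subst (2 ∣_) (split n M) 2∣nk) (divides (n * M) (double n M))
  where
  split : ∀ n M → n * suc (M + M) ≡ n * (M + M) + n
  split = solve-∀
  double : ∀ n M → n * (M + M) ≡ n * M * 2
  double = solve-∀

windowColouring : ∀ k n → 2 ≤ k → 1 ≤ n → 2 ∣ n * k → HasWindowColouring k n
windowColouring k (suc p) 2≤k _ 2∣nk with parity k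
... | even zero    = contradiction 2≤k λ ()
... | even (suc m) = evenCase m p
... | odd  zero    = contradiction 2≤k λ { (s≤s ()) }
... | odd  (suc M) with odd-factor (suc M) (suc p) 2∣nk
...   | divides (suc p′) n≡ =
  subst (HasWindowColouring (suc (suc M + suc M))) (trans (*-comm 2 (suc p′)) (sym n≡)) (oddCase (M + suc M) p′)

spread<degree : ∀ k n s → 2 ≤ k → 2 * suc s ≡ k * n → s < degree k n
spread<degree (suc k) n s (s≤s 1≤k) half = *-cancelˡ-≤ 2 (begin
  2 * suc s         ≡⟨ half ⟩
  n + k * n         ≤⟨ +-monoˡ-≤ (k * n) (subst (_≤ k * n) (*-identityˡ n) (*-monoˡ-≤ n 1≤k)) ⟩
  k * n + k * n     ≡⟨ double (k * n) ⟨
  2 * (k * n)       ∎)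
  where
  open ≤-Reasoning
  double : ∀ x → 2 * x ≡ x + x
  double = solve-∀

t≤spread+degree : ∀ k n s t → 1 ≤ k → 2 * suc s ≡ k * n →
  2 * t + 2 + 2 * n ≤ 3 * k * n → t ≤ s + degree k n
t≤spread+degree (suc k) n s t _ half t-bound = +-cancelʳ-≤ (suc n) t (s + k * n) (*-cancelˡ-≤ 2 (begin
  2 * (t + suc n)             ≡⟨ lhs t n ⟩
  2 * t + 2 + 2 * n           ≤⟨ t-bound ⟩
  3 * suc k * n               ≡⟨ rhs₁ k n ⟩
  suc k * n + 2 * (suc k * n) ≡⟨ cong (_+ 2 * (suc k * n)) (sym half) ⟩
  2 * suc s + 2 * (suc k * n) ≡⟨ rhs₂ s k n ⟩
  2 * (s + k * n + suc n)     ∎))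
  where
  open ≤-Reasoning
  lhs : ∀ t n → 2 * (t + suc n) ≡ 2 * t + 2 + 2 * n
  lhs = solve-∀
  rhs₁ : ∀ k n → 3 * suc k * n ≡ suc k * n + 2 * (suc k * n)
  rhs₁ = solve-∀
  rhs₂ : ∀ s k n → 2 * suc s + 2 * (suc k * n) ≡ 2 * (s + k * n + suc n)
  rhs₂ = solve-∀

corollary2 : (k n t : ℕ) → 2 ≤ k → 1 ≤ n → 2 ∣ n * k →
    (k ∸ 1) * n ≤ t → 2 * t + 2 + 2 * n ≤ 3 * k * n →
    IntervalColoring (CompleteBalancedMultipartite k n) t
corollary2 k n t 2≤k 1≤n 2∣nk D≤t t-bound =
  let (s , half , W) = windowColouring k n 2≤k 1≤n 2∣nk in
  Folding.intervalColouring W t (spread<degree k n s 2≤k half) D≤t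
    (t≤spread+degree k n s t (<⇒≤ 2≤k) half t-bound)
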